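{- Let $G=(V,E)$ be an $n$-vertex, $m$-edge graph with $n$ sufficiently large and $m\ge n\log^{10}n$, let $N=\lceil\sqrt{\bar d}\rceil$ where $\bar d=2m/n$, and let each vertex $v$ independently choose an index $i_v$ uniformly at random from $\{1,\dots,N\}$; set $V_i=\{v: i_v=i\}$. Then for every $i\in\{1,\dots,N\}$, the induced subgraph $G[V_i]$ contains $\tilde O(n)$ edges with high probability.
   Context: "With high probability" means with probability at least $1-n^{ -c}$ for an arbitrary constant $c$; $\tilde O$ hides polylogarithmic factors in $n$. -}

module Defs where

open import Data.Nat using (ℕ; zero; suc; _+_; _*_; _^_; _≤_; _<_; _<ᵇ_)
open import Data.Nat.Logarithm using (⌈log₂_⌉)
open import Data.Bool using (Bool; true; false; _∧_)
open import Data.Fin using (Fin; toℕ; _≟_)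
open import Data.Vec using (Vec; []; _∷_; lookup)
open import Data.List using (List; []; _∷_; map; concatMap; allFin; filterᵇ; length)
open import Data.Product using (_×_; _,_)
open import Relation.Binary.PropositionalEquality using (_≡_)
open import Relation.Nullary.Decidable using (⌊_⌋)

record Graph (n : ℕ) : Set where
  field
    adj    : Fin n → Fin n → Bool
    sym    : ∀ u v → adj u v ≡ adj v u
    irrefl : ∀ v → adj v v ≡ false
open Graph public

-- unordered pairs {u,v}, represented as (u , v) with u < v
pairs : (n : ℕ) → List (Fin n × Fin n)
pairs n = concatMap (λ u → map (u ,_) (filterᵇ (λ v → toℕ u <ᵇ toℕ v) (allFin n))) (allFin n)

edgesWithin : ∀ {n} → Graph n → (Fin n → Bool) → ℕ
edgesWithin {n} G S =
  length (filterᵇ (λ { (u , v) → adj G u v ∧ (S u ∧ S v) }) (pairs n))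

numEdges : ∀ {n} → Graph n → ℕ
numEdges G = edgesWithin G (λ _ → true)

-- n * (log₂ n)^10 ≤ m, stated exactly: log₂ n = sup { p/q : 2^p ≤ n^q, q > 0 }
LogHyp : ℕ → ℕ → Set
LogHyp n m = ∀ p q → 0 < q → 2 ^ p ≤ n ^ q → p ^ 10 * n ≤ q ^ 10 * m

-- N = ⌈ √(2m/n) ⌉, i.e. N is the least natural number with N² ≥ 2m/n
IsCeilSqrtAvgDeg : ℕ → ℕ → ℕ → Set
IsCeilSqrtAvgDeg n m N = (2 * m ≤ N * N * n) × (∀ M → 2 * m ≤ M * M * n → N ≤ M)

-- all assignments v ↦ i_v ∈ Fin N (the uniform sample space, size N^n)
allAssignments : (N n : ℕ) → List (Vec (Fin N) n)
allAssignments N zero = [] ∷ []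
allAssignments N (suc n) =
  concatMap (λ x → map (x ∷_) (allAssignments N n)) (allFin N)

classOf : ∀ {N n} → Vec (Fin N) n → Fin N → Fin n → Bool
classOf σ i v = ⌊ lookup σ v ≟ i ⌋

badCount : ∀ {n} (G : Graph n) (N : ℕ) (i : Fin N) (B : ℕ) → ℕ
badCount {n} G N i B =
  length (filterᵇ (λ σ → B <ᵇ edgesWithin G (classOf σ i)) (allAssignments N n))

{-# OPTIONS --safe #-}
module Submission where

-- Fix the class S = V_i and put h ≈ N/2 and L = (c+1)⌈log₂ n⌉. Call v heavy if it has more
-- than deg(v)/h + L neighbours in S. If no vertex is heavy, counting each edge of G[S] at one
-- endpoint and double counting give h²·e(S) ≤ 2m + 2h²nL ≤ h²n(9 + 2L), since 2m ≤ N²n ≤ 9h²n.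
-- For a fixed v the number X of neighbours of v in S has E[2^X] = (1 + 1/N)^deg(v), which is
-- at most 2^(deg(v)/h + 1); so by Markov's inequality v is heavy with probability at most
-- 2^-L ≤ n^-(c+1), and a union bound over the n vertices finishes. Probabilities appear as
-- counts of assignments, i.e. multiplied by N^n.

open import Data.Bool using (Bool; true; false; _∧_; T)
open import Data.Bool.Properties using (T-≡; ¬-not; ∧-identityʳ)
open import Data.Fin using (Fin; toℕ; _≟_) renaming (zero to fzero; suc to fsuc)
open import Data.Fin.Properties using (toℕ-injective; any?)
open import Data.List using (List; []; _∷_; map; concatMap; allFin; filterᵇ; length; tabulate; _++_)
open import Data.Nat
  using (ℕ; zero; suc; _+_; _*_; _^_; _∸_; _/_; _%_; ⌈_/2⌉; _≤_; _<_; _<ᵇ_; _≤ᵇ_; z≤n; s≤s; s≤s⁻¹; NonZero)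
open import Data.Nat.DivMod using (m≡m%n+[m/n]*n; m%n<n; m/n*n≤m)
open import Data.Nat.Induction using (<-wellFounded)
open import Data.Nat.Logarithm using (⌈log₂_⌉)
open import Data.Nat.Logarithm.Core using (⌈log2⌉)
open import Data.Nat.Properties hiding (_≟_)
open import Algebra.Properties.CommutativeSemigroup *-commutativeSemigroup using (x∙yz≈y∙xz)
open import Algebra.Properties.Semiring.Sum +-*-semiring
  using (sum; sum-syntax; sum-cong-≗; ∑-distrib-+; ∑-comm; *-distribˡ-sum; *-distribʳ-sum; sum-remove)
open import Data.Nat.Tactic.RingSolver using (solve-∀)
open import Data.Product using (Σ; _×_; _,_; ∃-syntax)
open import Data.Unit using (tt)
open import Data.Vec using (Vec; _∷_)
open import Function using (_∘_)
open import Function.Bundles using (Equivalence)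
open import Induction.WellFounded using (Acc; acc)
open import Relation.Binary using (tri<; tri≈; tri>)
open import Relation.Binary.PropositionalEquality
open import Relation.Nullary using (¬_; yes; no; contradiction)
open import Relation.Nullary.Decidable using (⌊_⌋; ⌊⌋-map′; T?)

open import Defs renaming (sym to adj-sym)

open ≤-Reasoning

𝟙 : Bool → ℕ
𝟙 true  = 1
𝟙 false = 0

𝟙-∧ : ∀ a b → 𝟙 (a ∧ b) ≡ 𝟙 a * 𝟙 b
𝟙-∧ true  b = sym (+-identityʳ (𝟙 b))
𝟙-∧ false b = refl

T⇒𝟙≡1 : ∀ {b} → T b → 𝟙 b ≡ 1
T⇒𝟙≡1 {true} _ = refl

∑-mono-≤ : ∀ {n} {f g : Fin n → ℕ} → (∀ i → f i ≤ g i) → ∑[ i < n ] f i ≤ ∑[ i < n ] g i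
∑-mono-≤ {zero}  _   = z≤n
∑-mono-≤ {suc n} f≤g = +-mono-≤ (f≤g fzero) (∑-mono-≤ (f≤g ∘ fsuc))

∑-const : ∀ n c → ∑[ i < n ] c ≡ n * c
∑-const zero    c = refl
∑-const (suc n) c = cong (c +_) (∑-const n c)

∑-scaled-≤ : ∀ {n} {f g : Fin n → ℕ} h c → (∀ i → h * f i ≤ g i + c) → h * sum f ≤ sum g + n * c
∑-scaled-≤ {n} {f} {g} h c hf≤g+c = begin
  h * sum f                     ≡⟨ *-distribˡ-sum h f ⟩
  ∑[ i < n ] (h * f i)          ≤⟨ ∑-mono-≤ hf≤g+c ⟩
  ∑[ i < n ] (g i + c)          ≡⟨ ∑-distrib-+ g (λ _ → c) ⟩
  sum g + ∑[ i < n ] c          ≡⟨ cong (sum g +_) (∑-const n c) ⟩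
  sum g + n * c                 ∎

term≤∑ : ∀ {n} (f : Fin n → ℕ) i → f i ≤ sum f
term≤∑ {suc n} f i = ≤-trans (m≤m+n (f i) _) (≤-reflexive (sym (sum-remove f)))

∑ₗ : {A : Set} → List A → (A → ℕ) → ℕ
∑ₗ []       f = 0
∑ₗ (x ∷ xs) f = f x + ∑ₗ xs f

infixl 10 ∑ₗ
syntax ∑ₗ xs (λ x → e) = ∑[ x ∈ xs ] e

module _ {A : Set} where

  ∑ₗ-cong : ∀ xs {f g : A → ℕ} → (∀ x → f x ≡ g x) → ∑ₗ xs f ≡ ∑ₗ xs g
  ∑ₗ-cong []       f≗g = refl
  ∑ₗ-cong (x ∷ xs) f≗g = cong₂ _+_ (f≗g x) (∑ₗ-cong xs f≗g)

  ∑ₗ-mono-≤ : ∀ xs {f g : A → ℕ} → (∀ x → f x ≤ g x) → ∑ₗ xs f ≤ ∑ₗ xs g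
  ∑ₗ-mono-≤ []       f≤g = z≤n
  ∑ₗ-mono-≤ (x ∷ xs) f≤g = +-mono-≤ (f≤g x) (∑ₗ-mono-≤ xs f≤g)

  ∑ₗ-++ : ∀ xs ys (f : A → ℕ) → ∑ₗ (xs ++ ys) f ≡ ∑ₗ xs f + ∑ₗ ys f
  ∑ₗ-++ []       ys f = refl
  ∑ₗ-++ (x ∷ xs) ys f = trans (cong (f x +_) (∑ₗ-++ xs ys f)) (sym (+-assoc (f x) _ _))

  ∑ₗ-filterᵇ : ∀ (p : A → Bool) xs (f : A → ℕ) →
               ∑ₗ (filterᵇ p xs) f ≡ ∑[ x ∈ xs ] (𝟙 (p x) * f x)
  ∑ₗ-filterᵇ p []       f = refl
  ∑ₗ-filterᵇ p (x ∷ xs) f with p x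
  ... | true  = cong₂ _+_ (sym (+-identityʳ (f x))) (∑ₗ-filterᵇ p xs f)
  ... | false = ∑ₗ-filterᵇ p xs f

  length-filterᵇ : ∀ (p : A → Bool) xs → length (filterᵇ p xs) ≡ ∑[ x ∈ xs ] 𝟙 (p x)
  length-filterᵇ p []       = refl
  length-filterᵇ p (x ∷ xs) with p x
  ... | true  = cong suc (length-filterᵇ p xs)
  ... | false = length-filterᵇ p xs

  *-distribˡ-∑ₗ : ∀ c xs (f : A → ℕ) → c * ∑ₗ xs f ≡ ∑[ x ∈ xs ] (c * f x)
  *-distribˡ-∑ₗ c []       f = *-zeroʳ c
  *-distribˡ-∑ₗ c (x ∷ xs) f = trans (*-distribˡ-+ c (f x) _) (cong (c * f x +_) (*-distribˡ-∑ₗ c xs f))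

  ∑ₗ-comm-∑ : ∀ {n} xs (f : Fin n → A → ℕ) → ∑[ x ∈ xs ] ∑[ v < n ] f v x ≡ ∑[ v < n ] ∑ₗ xs (f v)
  ∑ₗ-comm-∑ {n} []       f = sym (trans (∑-const n 0) (*-zeroʳ n))
  ∑ₗ-comm-∑ (x ∷ xs) f =
    trans (cong (sum (λ v → f v x) +_) (∑ₗ-comm-∑ xs f)) (sym (∑-distrib-+ (λ v → f v x) _))

module _ {A B : Set} where

  ∑ₗ-map : ∀ (g : A → B) xs (f : B → ℕ) → ∑ₗ (map g xs) f ≡ ∑[ x ∈ xs ] f (g x)
  ∑ₗ-map g []       f = refl
  ∑ₗ-map g (x ∷ xs) f = cong (f (g x) +_) (∑ₗ-map g xs f)

  ∑ₗ-concatMap : ∀ (g : A → List B) xs (f : B → ℕ) → ∑ₗ (concatMap g xs) f ≡ ∑[ x ∈ xs ] ∑ₗ (g x) f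
  ∑ₗ-concatMap g []       f = refl
  ∑ₗ-concatMap g (x ∷ xs) f = trans (∑ₗ-++ (g x) _ f) (cong (∑ₗ (g x) f +_) (∑ₗ-concatMap g xs f))

∑ₗ-tabulate : ∀ {A : Set} {n} (g : Fin n → A) (f : A → ℕ) → ∑ₗ (tabulate g) f ≡ ∑[ i < n ] f (g i)
∑ₗ-tabulate {n = zero}  g f = refl
∑ₗ-tabulate {n = suc n} g f = cong (f (g fzero) +_) (∑ₗ-tabulate (g ∘ fsuc) f)

∑ₗ-allFin : ∀ {n} (f : Fin n → ℕ) → ∑ₗ (allFin n) f ≡ sum f
∑ₗ-allFin f = ∑ₗ-tabulate (λ i → i) f

module _ {A : Set} where

  markov : ∀ (w : ℕ → ℕ) → (∀ {a b} → a ≤ b → w a ≤ w b) → ∀ t (f : A → ℕ) xs →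
           length (filterᵇ (λ x → t ≤ᵇ f x) xs) * w t ≤ ∑[ x ∈ xs ] w (f x)
  markov w w-mono t f []       = z≤n
  markov w w-mono t f (x ∷ xs) with t ≤ᵇ f x in t≤ᵇfx
  ... | true  = +-mono-≤ (w-mono (≤ᵇ⇒≤ t (f x) (subst T (sym t≤ᵇfx) tt))) (markov w w-mono t f xs)
  ... | false = ≤-trans (markov w w-mono t f xs) (m≤n+m _ (w (f x)))

  union-bound : ∀ {n} (p : A → Bool) (q : Fin n → A → Bool) xs →
                (∀ x → T (p x) → ∃[ v ] T (q v x)) →
                length (filterᵇ p xs) ≤ ∑[ v < n ] length (filterᵇ (q v) xs)
  union-bound {n} p q xs cover = begin
    length (filterᵇ p xs)                 ≡⟨ length-filterᵇ p xs ⟩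
    ∑[ x ∈ xs ] 𝟙 (p x)                   ≤⟨ ∑ₗ-mono-≤ xs 𝟙p≤∑𝟙q ⟩
    ∑[ x ∈ xs ] ∑[ v < n ] 𝟙 (q v x)      ≡⟨ ∑ₗ-comm-∑ xs (λ v x → 𝟙 (q v x)) ⟩
    ∑[ v < n ] ∑[ x ∈ xs ] 𝟙 (q v x)      ≡⟨ sum-cong-≗ (λ v → sym (length-filterᵇ (q v) xs)) ⟩
    ∑[ v < n ] length (filterᵇ (q v) xs)  ∎
    where
    𝟙p≤∑𝟙q : ∀ x → 𝟙 (p x) ≤ ∑[ v < n ] 𝟙 (q v x)
    𝟙p≤∑𝟙q x with p x in px
    ... | false = z≤n
    ... | true with cover x (subst T (sym px) tt)
    ...   | v , qvx = ≤-trans (≤-reflexive (sym (T⇒𝟙≡1 qvx))) (term≤∑ (λ v → 𝟙 (q v x)) v)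

_∩_ : ∀ {n} → (Fin n → Bool) → (Fin n → Bool) → Fin n → Bool
(A ∩ B) u = A u ∧ B u

∣_∣ : ∀ {n} → (Fin n → Bool) → ℕ
∣_∣ {n} A = ∑[ u < n ] 𝟙 (A u)

deg : ∀ {n} → Graph n → (Fin n → Bool) → Fin n → ℕ
deg G S u = ∣ adj G u ∩ S ∣

<ᵇ≡true : ∀ {m n} → m < n → (m <ᵇ n) ≡ true
<ᵇ≡true = Equivalence.to T-≡ ∘ <⇒<ᵇ

<ᵇ≡false : ∀ {m n} → ¬ m < n → (m <ᵇ n) ≡ false
<ᵇ≡false {m} {n} m≮n = ¬-not (m≮n ∘ <ᵇ⇒< m n ∘ Equivalence.from T-≡)

module _ {n} (G : Graph n) where

  edgeIndicator : (Fin n → Bool) → Fin n → Fin n → ℕ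
  edgeIndicator S u v = 𝟙 (toℕ u <ᵇ toℕ v) * 𝟙 (adj G u v ∧ (S u ∧ S v))

  edgesWithin≡∑∑ : ∀ S → edgesWithin G S ≡ ∑[ u < n ] ∑[ v < n ] edgeIndicator S u v
  edgesWithin≡∑∑ S =
    trans (length-filterᵇ _ (pairs n))
    (trans (∑ₗ-concatMap _ (allFin n) _)
    (trans (∑ₗ-cong (allFin n) (λ u →
             trans (∑ₗ-map (u ,_) (filterᵇ (λ v → toℕ u <ᵇ toℕ v) (allFin n)) _)
             (trans (∑ₗ-filterᵇ (λ v → toℕ u <ᵇ toℕ v) (allFin n) _)
                    (∑ₗ-allFin (edgeIndicator S u)))))
    (∑ₗ-allFin (λ u → ∑[ v < n ] edgeIndicator S u v))))

  edgesWithin≤∑deg : ∀ S → edgesWithin G S ≤ ∑[ u < n ] (𝟙 (S u) * deg G S u)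
  edgesWithin≤∑deg S = begin
    edgesWithin G S
      ≡⟨ edgesWithin≡∑∑ S ⟩
    ∑[ u < n ] ∑[ v < n ] edgeIndicator S u v
      ≤⟨ ∑-mono-≤ (λ u → ∑-mono-≤ (λ v → counted-at-u (adj G u v) (S u) (S v) (toℕ u <ᵇ toℕ v))) ⟩
    ∑[ u < n ] ∑[ v < n ] (𝟙 (S u) * 𝟙 (adj G u v ∧ S v))
      ≡⟨ sum-cong-≗ (λ u → *-distribˡ-sum (𝟙 (S u)) (λ v → 𝟙 (adj G u v ∧ S v))) ⟨
    ∑[ u < n ] (𝟙 (S u) * deg G S u)
      ∎
    where
    counted-at-u : ∀ a b c d → 𝟙 d * 𝟙 (a ∧ (b ∧ c)) ≤ 𝟙 b * 𝟙 (a ∧ c)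
    counted-at-u a     b     c false = z≤n
    counted-at-u a     true  c true  = ≤-refl
    counted-at-u false false c true  = z≤n
    counted-at-u true  false c true  = z≤n

  ∑𝟙*∣adj∣≡∑deg : ∀ S → ∑[ u < n ] (𝟙 (S u) * ∣ adj G u ∣) ≡ ∑[ v < n ] deg G S v
  ∑𝟙*∣adj∣≡∑deg S = begin-equality
    ∑[ u < n ] (𝟙 (S u) * ∣ adj G u ∣)                ≡⟨ sum-cong-≗ (λ u → *-distribˡ-sum (𝟙 (S u)) (λ v → 𝟙 (adj G u v))) ⟩
    ∑[ u < n ] ∑[ v < n ] (𝟙 (S u) * 𝟙 (adj G u v))  ≡⟨ ∑-comm (λ u v → 𝟙 (S u) * 𝟙 (adj G u v)) ⟩
    ∑[ v < n ] ∑[ u < n ] (𝟙 (S u) * 𝟙 (adj G u v))  ≡⟨ sum-cong-≗ (λ v → sum-cong-≗ (λ u → flip-edge u v)) ⟩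
    ∑[ v < n ] deg G S v                              ∎
    where
    flip-edge : ∀ u v → 𝟙 (S u) * 𝟙 (adj G u v) ≡ 𝟙 (adj G v u ∧ S u)
    flip-edge u v = begin-equality
      𝟙 (S u) * 𝟙 (adj G u v)  ≡⟨ *-comm (𝟙 (S u)) _ ⟩
      𝟙 (adj G u v) * 𝟙 (S u)  ≡⟨ 𝟙-∧ (adj G u v) (S u) ⟨
      𝟙 (adj G u v ∧ S u)      ≡⟨ cong (λ b → 𝟙 (b ∧ S u)) (adj-sym G u v) ⟩
      𝟙 (adj G v u ∧ S u)      ∎

  handshake : ∑[ u < n ] ∣ adj G u ∣ ≡ 2 * numEdges G
  handshake = begin-equality
    ∑[ u < n ] ∑[ v < n ] 𝟙 (adj G u v)               ≡⟨ sum-cong-≗ (λ u → sum-cong-≗ (λ v → split u v)) ⟩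
    ∑[ u < n ] ∑[ v < n ] (E u v + E v u)             ≡⟨ sum-cong-≗ (λ u → ∑-distrib-+ (E u) (λ v → E v u)) ⟩
    ∑[ u < n ] (∑[ v < n ] E u v + ∑[ v < n ] E v u)  ≡⟨ ∑-distrib-+ (λ u → ∑[ v < n ] E u v) (λ u → ∑[ v < n ] E v u) ⟩
    m + ∑[ u < n ] ∑[ v < n ] E v u                   ≡⟨ cong (m +_) (∑-comm (λ u v → E v u)) ⟩
    m + m                                             ≡⟨ cong (m +_) (+-identityʳ m) ⟨
    2 * m                                             ≡⟨ cong (2 *_) (edgesWithin≡∑∑ (λ _ → true)) ⟨
    2 * numEdges G                                    ∎
    where
    E : Fin n → Fin n → ℕ
    E = edgeIndicator (λ _ → true)
    m : ℕ
    m = ∑[ u < n ] ∑[ v < n ] E u v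
    split : ∀ u v → 𝟙 (adj G u v) ≡ 𝟙 (toℕ u <ᵇ toℕ v) * 𝟙 (adj G u v ∧ true)
                                    + 𝟙 (toℕ v <ᵇ toℕ u) * 𝟙 (adj G v u ∧ true)
    split u v rewrite ∧-identityʳ (adj G u v) | ∧-identityʳ (adj G v u) | adj-sym G v u
      with <-cmp (toℕ u) (toℕ v)
    ... | tri< u<v _ v≮u rewrite <ᵇ≡true u<v | <ᵇ≡false v≮u = sym (trans (+-identityʳ _) (+-identityʳ _))
    ... | tri> u≮v _ v<u rewrite <ᵇ≡false u≮v | <ᵇ≡true v<u = sym (+-identityʳ _)
    ... | tri≈ _ u≡v _ rewrite toℕ-injective u≡v | Graph.irrefl G v =
          sym (cong₂ _+_ (*-zeroʳ (𝟙 (toℕ v <ᵇ toℕ v))) (*-zeroʳ (𝟙 (toℕ v <ᵇ toℕ v))))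

  h*h*edgesWithin≤ : ∀ S h L → (∀ v → h * deg G S v ≤ ∣ adj G v ∣ + h * L) →
                     h * (h * edgesWithin G S) ≤ 2 * numEdges G + n * (h * L) + h * (n * (h * L))
  h*h*edgesWithin≤ S h L hdeg≤ = begin
    h * (h * edgesWithin G S)                       ≤⟨ *-monoʳ-≤ h (*-monoʳ-≤ h (edgesWithin≤∑deg S)) ⟩
    h * (h * ∑[ u < n ] (𝟙 (S u) * deg G S u))      ≤⟨ *-monoʳ-≤ h (∑-scaled-≤ h (h * L) weighted) ⟩
    h * (X + n * (h * L))                           ≡⟨ *-distribˡ-+ h X (n * (h * L)) ⟩
    h * X + h * (n * (h * L))                       ≤⟨ +-monoˡ-≤ (h * (n * (h * L))) hX≤ ⟩
    2 * numEdges G + n * (h * L) + h * (n * (h * L)) ∎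
    where
    X : ℕ
    X = ∑[ u < n ] (𝟙 (S u) * ∣ adj G u ∣)
    weighted : ∀ u → h * (𝟙 (S u) * deg G S u) ≤ 𝟙 (S u) * ∣ adj G u ∣ + h * L
    weighted u with S u
    ... | true  rewrite +-identityʳ (deg G S u) | +-identityʳ ∣ adj G u ∣ = hdeg≤ u
    ... | false = ≤-trans (≤-reflexive (*-zeroʳ h)) z≤n
    hX≤ : h * X ≤ 2 * numEdges G + n * (h * L)
    hX≤ = begin
      h * X                                 ≡⟨ cong (h *_) (∑𝟙*∣adj∣≡∑deg S) ⟩
      h * ∑[ v < n ] deg G S v              ≤⟨ ∑-scaled-≤ h (h * L) hdeg≤ ⟩
      ∑[ v < n ] ∣ adj G v ∣ + n * (h * L)  ≡⟨ cong (_+ n * (h * L)) handshake ⟩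
      2 * numEdges G + n * (h * L)          ∎

  edgesWithin≤n*[9+2L] : ∀ S N h L .{{_ : NonZero h}} → N ≤ 3 * h → 2 * numEdges G ≤ N * N * n →
                         (∀ v → h * deg G S v ≤ ∣ adj G v ∣ + h * L) → edgesWithin G S ≤ n * (9 + 2 * L)
  edgesWithin≤n*[9+2L] S N h L N≤3h 2m≤N²n hdeg≤ = *-cancelˡ-≤ (h * h) {{m*n≢0 h h}} (begin
    h * h * edgesWithin G S                                      ≡⟨ *-assoc h h _ ⟩
    h * (h * edgesWithin G S)                                    ≤⟨ h*h*edgesWithin≤ S h L hdeg≤ ⟩
    2 * numEdges G + n * (h * L) + h * (n * (h * L))             ≤⟨ +-monoˡ-≤ _ (+-mono-≤ 2m≤9h²n (m≤n*m _ h)) ⟩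
    3 * h * (3 * h) * n + h * (n * (h * L)) + h * (n * (h * L))  ≡⟨ regroup h n L ⟩
    h * h * (n * (9 + 2 * L))                                    ∎)
    where
    2m≤9h²n : 2 * numEdges G ≤ 3 * h * (3 * h) * n
    2m≤9h²n = ≤-trans 2m≤N²n (*-monoˡ-≤ n (*-mono-≤ N≤3h N≤3h))
    regroup : ∀ h n L → 3 * h * (3 * h) * n + h * (n * (h * L)) + h * (n * (h * L)) ≡ h * h * (n * (9 + 2 * L))
    regroup = solve-∀

N*[1+N]^k≤N^k*[N+2k] : ∀ N k → 2 * k ≤ N → N * suc N ^ k ≤ N ^ k * (N + 2 * k)
N*[1+N]^k≤N^k*[N+2k] N zero    _      = ≤-reflexive (base N)
  where
  base : ∀ N → N * 1 ≡ 1 * (N + 2 * 0)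
  base = solve-∀
N*[1+N]^k≤N^k*[N+2k] N (suc k) 2k+2≤N = begin
  N * (suc N * suc N ^ k)                  ≡⟨ x∙yz≈y∙xz N (suc N) (suc N ^ k) ⟩
  suc N * (N * suc N ^ k)                  ≤⟨ *-monoʳ-≤ (suc N) (N*[1+N]^k≤N^k*[N+2k] N k 2k≤N) ⟩
  suc N * (N ^ k * (N + 2 * k))            ≡⟨ expand N (N ^ k) k ⟩
  N ^ k * (N * (N + 2 * k) + (N + 2 * k))  ≤⟨ *-monoʳ-≤ (N ^ k) (+-monoʳ-≤ (N * (N + 2 * k)) (+-monoʳ-≤ N 2k≤N)) ⟩
  N ^ k * (N * (N + 2 * k) + (N + N))      ≡⟨ collect N (N ^ k) k ⟩
  N * N ^ k * (N + 2 * suc k)              ∎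
  where
  2k≤N : 2 * k ≤ N
  2k≤N = ≤-trans (*-monoʳ-≤ 2 (n≤1+n k)) 2k+2≤N
  expand : ∀ N p k → suc N * (p * (N + 2 * k)) ≡ p * (N * (N + 2 * k) + (N + 2 * k))
  expand = solve-∀
  collect : ∀ N p k → p * (N * (N + 2 * k) + (N + N)) ≡ N * p * (N + 2 * suc k)
  collect = solve-∀

[1+N]^k≤2*N^k : ∀ N k .{{_ : NonZero N}} → 2 * k ≤ N → suc N ^ k ≤ 2 * N ^ k
[1+N]^k≤2*N^k N k 2k≤N = *-cancelˡ-≤ N (begin
  N * suc N ^ k        ≤⟨ N*[1+N]^k≤N^k*[N+2k] N k 2k≤N ⟩
  N ^ k * (N + 2 * k)  ≤⟨ *-monoʳ-≤ (N ^ k) (+-monoʳ-≤ N 2k≤N) ⟩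
  N ^ k * (N + N)      ≡⟨ regroup N (N ^ k) ⟩
  N * (2 * N ^ k)      ∎)
  where
  regroup : ∀ N p → p * (N + N) ≡ N * (2 * p)
  regroup = solve-∀

x^[h*s]≤c^s*y^[h*s] : ∀ x y c h s → x ^ h ≤ c * y ^ h → x ^ (h * s) ≤ c ^ s * y ^ (h * s)
x^[h*s]≤c^s*y^[h*s] x y c h zero    _ rewrite *-zeroʳ h = ≤-refl
x^[h*s]≤c^s*y^[h*s] x y c h (suc s) x^h≤cy^h
  rewrite *-suc h s | ^-distribˡ-+-* x h (h * s) | ^-distribˡ-+-* y h (h * s) = begin
  x ^ h * x ^ (h * s)                    ≤⟨ *-mono-≤ x^h≤cy^h (x^[h*s]≤c^s*y^[h*s] x y c h s x^h≤cy^h) ⟩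
  c * y ^ h * (c ^ s * y ^ (h * s))      ≡⟨ [m*n]*[o*p]≡[m*o]*[n*p] c (y ^ h) (c ^ s) (y ^ (h * s)) ⟩
  c * c ^ s * (y ^ h * y ^ (h * s))      ∎

x^[a+d]≤c*y^[a+d]⇒x^a≤c*y^a : ∀ {x y c} a d .{{_ : NonZero y}} → y ≤ x →
                               x ^ (a + d) ≤ c * y ^ (a + d) → x ^ a ≤ c * y ^ a
x^[a+d]≤c*y^[a+d]⇒x^a≤c*y^a {x} {y} {c} a d y≤x bound = *-cancelʳ-≤ (x ^ a) (c * y ^ a) (y ^ d) {{m^n≢0 y d}} (begin
  x ^ a * y ^ d        ≤⟨ *-monoʳ-≤ (x ^ a) (^-monoˡ-≤ d y≤x) ⟩
  x ^ a * x ^ d        ≡⟨ ^-distribˡ-+-* x a d ⟨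
  x ^ (a + d)          ≤⟨ bound ⟩
  c * y ^ (a + d)      ≡⟨ cong (c *_) (^-distribˡ-+-* y a d) ⟩
  c * (y ^ a * y ^ d)  ≡⟨ *-assoc c (y ^ a) (y ^ d) ⟨
  c * y ^ a * y ^ d    ∎)

[1+N]^a≤2^s*N^a : ∀ N h s a .{{_ : NonZero N}} → suc N ^ h ≤ 2 * N ^ h → a ≤ h * s →
                  suc N ^ a ≤ 2 ^ s * N ^ a
[1+N]^a≤2^s*N^a N h s a [1+N]^h≤2N^h a≤hs =
  x^[a+d]≤c*y^[a+d]⇒x^a≤c*y^a {c = 2 ^ s} a (h * s ∸ a) (n≤1+n N)
    (subst (λ e → suc N ^ e ≤ 2 ^ s * N ^ e) (sym (m+[n∸m]≡n a≤hs))
           (x^[h*s]≤c^s*y^[h*s] (suc N) N 2 h s [1+N]^h≤2N^h))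

∑ₗ-allAssignments-suc : ∀ {N n} (f : Vec (Fin N) (suc n) → ℕ) →
                        ∑ₗ (allAssignments N (suc n)) f ≡ ∑[ x < N ] ∑[ σ ∈ allAssignments N n ] f (x ∷ σ)
∑ₗ-allAssignments-suc {N} {n} f =
  trans (∑ₗ-concatMap (λ x → map (x ∷_) (allAssignments N n)) (allFin N) f)
  (trans (∑ₗ-cong (allFin N) (λ x → ∑ₗ-map (x ∷_) (allAssignments N n) f))
         (∑ₗ-allFin (λ x → ∑[ σ ∈ allAssignments N n ] f (x ∷ σ))))

∑2^𝟙[x≡i]≡1+N : ∀ {N} (i : Fin N) → ∑[ x < N ] (2 ^ 𝟙 ⌊ x ≟ i ⌋) ≡ suc N
∑2^𝟙[x≡i]≡1+N {suc N} fzero    = cong (2 +_) (trans (∑-const N 1) (*-identityʳ N))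
∑2^𝟙[x≡i]≡1+N {suc N} (fsuc i) = cong suc (trans
  (sum-cong-≗ (λ x → cong (λ b → 2 ^ 𝟙 b) (⌊⌋-map′ _ _ (x ≟ i))))
  (∑2^𝟙[x≡i]≡1+N i))

-- Divided by N ^ (n + ∣ A ∣), this says E[2^X] = (1 + 1/N)^∣A∣ for X = ∣ A ∩ V_i ∣.
exponentialMoment : ∀ N n (i : Fin N) (A : Fin n → Bool) →
                    (∑[ σ ∈ allAssignments N n ] (2 ^ ∣ A ∩ classOf σ i ∣)) * N ^ ∣ A ∣ ≡ suc N ^ ∣ A ∣ * N ^ n
exponentialMoment N zero    i A = refl
exponentialMoment N (suc n) i A = begin-equality
  M A * N ^ (b + a)                     ≡⟨ cong (_* N ^ (b + a)) split ⟩
  W * M A′ * N ^ (b + a)                ≡⟨ cong (W * M A′ *_) (^-distribˡ-+-* N b a) ⟩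
  W * M A′ * (N ^ b * N ^ a)            ≡⟨ [m*n]*[o*p]≡[m*o]*[n*p] W (M A′) (N ^ b) (N ^ a) ⟩
  W * N ^ b * (M A′ * N ^ a)            ≡⟨ cong₂ _*_ (weight (A fzero)) (exponentialMoment N n i A′) ⟩
  suc N ^ b * N * (suc N ^ a * N ^ n)   ≡⟨ [m*n]*[o*p]≡[m*o]*[n*p] (suc N ^ b) N (suc N ^ a) (N ^ n) ⟩
  suc N ^ b * suc N ^ a * (N * N ^ n)   ≡⟨ cong (_* N ^ suc n) (^-distribˡ-+-* (suc N) b a) ⟨
  suc N ^ (b + a) * N ^ suc n           ∎
  where
  M : ∀ {k} → (Fin k → Bool) → ℕ
  M {k} B = ∑[ σ ∈ allAssignments N k ] (2 ^ ∣ B ∩ classOf σ i ∣)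
  A′ : Fin n → Bool
  A′ = A ∘ fsuc
  b a : ℕ
  b = 𝟙 (A fzero)
  a = ∣ A′ ∣
  p : Fin N → ℕ
  p x = 𝟙 (A fzero ∧ ⌊ x ≟ i ⌋)
  W : ℕ
  W = ∑[ x < N ] (2 ^ p x)
  factor : ∀ x → ∑[ σ ∈ allAssignments N n ] (2 ^ (p x + ∣ A′ ∩ classOf σ i ∣)) ≡ 2 ^ p x * M A′
  factor x = trans (∑ₗ-cong (allAssignments N n) (λ σ → ^-distribˡ-+-* 2 (p x) ∣ A′ ∩ classOf σ i ∣))
                   (sym (*-distribˡ-∑ₗ (2 ^ p x) (allAssignments N n) (λ σ → 2 ^ ∣ A′ ∩ classOf σ i ∣)))
  split : M A ≡ W * M A′
  split = begin-equality
    M A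
      ≡⟨ ∑ₗ-allAssignments-suc (λ σ → 2 ^ ∣ A ∩ classOf σ i ∣) ⟩
    ∑[ x < N ] ∑[ σ ∈ allAssignments N n ] (2 ^ (p x + ∣ A′ ∩ classOf σ i ∣))
      ≡⟨ sum-cong-≗ factor ⟩
    ∑[ x < N ] (2 ^ p x * M A′)
      ≡⟨ *-distribʳ-sum (M A′) (λ x → 2 ^ p x) ⟨
    W * M A′
      ∎
  weight : ∀ b → (∑[ x < N ] (2 ^ 𝟙 (b ∧ ⌊ x ≟ i ⌋))) * N ^ 𝟙 b ≡ suc N ^ 𝟙 b * N
  weight true  = trans (cong (_* (N * 1)) (∑2^𝟙[x≡i]≡1+N i)) (regroup N)
    where
    regroup : ∀ N → suc N * (N * 1) ≡ suc N * 1 * N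
    regroup = solve-∀
  weight false = trans (*-identityʳ _) (trans (∑-const N 1) (trans (*-identityʳ N) (sym (+-identityʳ N))))

classTail : ∀ N n (i : Fin N) (A : Fin n → Bool) h s L .{{_ : NonZero N}} →
            suc N ^ h ≤ 2 * N ^ h → ∣ A ∣ ≤ h * s →
            length (filterᵇ (λ σ → s + L ≤ᵇ ∣ A ∩ classOf σ i ∣) (allAssignments N n)) * 2 ^ L ≤ N ^ n
classTail N n i A h s L [1+N]^h≤2N^h a≤hs =
  *-cancelˡ-≤ (2 ^ s * N ^ a) {{m*n≢0 (2 ^ s) (N ^ a) {{m^n≢0 2 s}} {{m^n≢0 N a}}}} (begin
    2 ^ s * N ^ a * (X * 2 ^ L)      ≡⟨ regroup (2 ^ s) (N ^ a) X (2 ^ L) ⟩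
    X * (2 ^ s * 2 ^ L) * N ^ a      ≡⟨ cong (λ e → X * e * N ^ a) (^-distribˡ-+-* 2 s L) ⟨
    X * 2 ^ (s + L) * N ^ a          ≤⟨ *-monoˡ-≤ (N ^ a) (markov (2 ^_) (^-monoʳ-≤ 2) (s + L) size (allAssignments N n)) ⟩
    (∑[ σ ∈ allAssignments N n ] (2 ^ size σ)) * N ^ a ≡⟨ exponentialMoment N n i A ⟩
    suc N ^ a * N ^ n                ≤⟨ *-monoˡ-≤ (N ^ n) ([1+N]^a≤2^s*N^a N h s a [1+N]^h≤2N^h a≤hs) ⟩
    2 ^ s * N ^ a * N ^ n            ∎)
  where
  a : ℕ
  a = ∣ A ∣
  size : Vec (Fin N) n → ℕ
  size σ = ∣ A ∩ classOf σ i ∣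
  X : ℕ
  X = length (filterᵇ (λ σ → s + L ≤ᵇ size σ) (allAssignments N n))
  regroup : ∀ t p x l → t * p * (x * l) ≡ x * (t * l) * p
  regroup = solve-∀

n≤2^⌈log₂n⌉ : ∀ n → n ≤ 2 ^ ⌈log₂ n ⌉
n≤2^⌈log₂n⌉ n = go n (<-wellFounded n)
  where
  go : ∀ n (rec : Acc _<_ n) → n ≤ 2 ^ ⌈log2⌉ n rec
  go zero                _        = z≤n
  go (suc zero)          _        = ≤-refl
  go (suc (suc n)) (acc rs) = begin
    2 + n                    ≤⟨ +-monoʳ-≤ 2 n≤⌈n/2⌉+⌈n/2⌉ ⟩
    2 + (⌈ n /2⌉ + ⌈ n /2⌉)  ≡⟨ regroup ⌈ n /2⌉ ⟩
    2 * suc ⌈ n /2⌉          ≤⟨ *-monoʳ-≤ 2 (go (suc ⌈ n /2⌉) (rs (⌈n/2⌉<n n))) ⟩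
    2 * 2 ^ ⌈log2⌉ (suc ⌈ n /2⌉) (rs (⌈n/2⌉<n n)) ∎
    where
    n≤⌈n/2⌉+⌈n/2⌉ : n ≤ ⌈ n /2⌉ + ⌈ n /2⌉
    n≤⌈n/2⌉+⌈n/2⌉ = subst (_≤ ⌈ n /2⌉ + ⌈ n /2⌉) (⌊n/2⌋+⌈n/2⌉≡n n) (+-monoˡ-≤ ⌈ n /2⌉ (⌊n/2⌋≤⌈n/2⌉ n))
    regroup : ∀ x → 2 + (x + x) ≡ 2 * suc x
    regroup = solve-∀

m≤n*[1+m/n] : ∀ m n .{{_ : NonZero n}} → m ≤ n * suc (m / n)
m≤n*[1+m/n] m n = begin
  m                  ≡⟨ m≡m%n+[m/n]*n m n ⟩
  m % n + m / n * n  ≤⟨ +-monoˡ-≤ (m / n * n) (<⇒≤ (m%n<n m n)) ⟩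
  n + m / n * n      ≡⟨ cong (n +_) (*-comm (m / n) n) ⟩
  n + n * (m / n)    ≡⟨ *-suc n (m / n) ⟨
  n * suc (m / n)    ∎

n*[m/n]≤m : ∀ m n .{{_ : NonZero n}} → n * (m / n) ≤ m
n*[m/n]≤m m n = ≤-trans (≤-reflexive (*-comm n (m / n))) (m/n*n≤m m n)

n*[9+2ℓk]≤[9+2k]*n*ℓ : ∀ n ℓ k .{{_ : NonZero ℓ}} → n * (9 + 2 * (ℓ * k)) ≤ (9 + 2 * k) * n * ℓ ^ 1
n*[9+2ℓk]≤[9+2k]*n*ℓ n ℓ k = begin
  n * (9 + 2 * (ℓ * k))      ≤⟨ *-monoʳ-≤ n (+-monoˡ-≤ (2 * (ℓ * k)) (m≤m*n 9 ℓ)) ⟩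
  n * (9 * ℓ + 2 * (ℓ * k))  ≡⟨ regroup n ℓ k ⟩
  (9 + 2 * k) * n * ℓ ^ 1    ∎
  where
  regroup : ∀ n l k → n * (9 * l + 2 * (l * k)) ≡ (9 + 2 * k) * n * (l * 1)
  regroup = solve-∀

halve : ∀ k → ∃[ h ] 2 * suc h ≤ 2 + k × 2 + k ≤ 3 * suc h
halve zero          = 0 , ≤-refl , s≤s (s≤s z≤n)
halve (suc zero)    = 0 , s≤s (s≤s z≤n) , s≤s (s≤s (s≤s z≤n))
halve (suc (suc k)) with halve k
... | h , 2h≤2+k , 2+k≤3h = suc h
  , subst (_≤ 4 + k) (sym (*-suc 2 (suc h))) (+-monoʳ-≤ 2 2h≤2+k)
  , subst (4 + k ≤_) (sym (*-suc 3 (suc h))) (+-monoʳ-≤ 2 (≤-trans 2+k≤3h (n≤1+n _)))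

-- h ≈ N/2, so that (1 + 1/N)^h ≤ 2 while N ≤ 3h; for N = 1, h = 1 does both.
balancedScale : ∀ N .{{_ : NonZero N}} → ∃[ h ] N ≤ 3 * suc h × suc N ^ suc h ≤ 2 * N ^ suc h
balancedScale (suc zero)          = 0 , s≤s z≤n , ≤-refl
balancedScale (suc (suc k)) with halve k
... | h , 2h≤N , N≤3h = h , N≤3h , [1+N]^k≤2*N^k (2 + k) (suc h) 2h≤N

badCount*2^L≤n*N^n : ∀ {n} (G : Graph n) N (i : Fin N) h L B .{{_ : NonZero N}} .{{_ : NonZero h}} →
                     suc N ^ h ≤ 2 * N ^ h → N ≤ 3 * h → 2 * numEdges G ≤ N * N * n → n * (9 + 2 * L) ≤ B →
                     badCount G N i B * 2 ^ L ≤ n * N ^ n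
badCount*2^L≤n*N^n {n} G N i h L B [1+N]^h≤2N^h N≤3h 2m≤N²n n[9+2L]≤B = begin
  badCount G N i B * 2 ^ L                             ≤⟨ *-monoˡ-≤ (2 ^ L) (union-bound _ heavy (allAssignments N n) cover) ⟩
  (∑[ v < n ] count v) * 2 ^ L                         ≡⟨ *-distribʳ-sum (2 ^ L) count ⟩
  ∑[ v < n ] (count v * 2 ^ L)                         ≤⟨ ∑-mono-≤ (λ v → classTail N n i (adj G v) h (s v) L [1+N]^h≤2N^h
                                                                               (m≤n*[1+m/n] ∣ adj G v ∣ h)) ⟩
  ∑[ v < n ] (N ^ n)                                   ≡⟨ ∑-const n (N ^ n) ⟩
  n * N ^ n                                            ∎
  where
  s : Fin n → ℕ
  s v = suc (∣ adj G v ∣ / h)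
  heavy : Fin n → Vec (Fin N) n → Bool
  heavy v σ = s v + L ≤ᵇ deg G (classOf σ i) v
  count : Fin n → ℕ
  count v = length (filterᵇ (heavy v) (allAssignments N n))
  light⇒bounded : ∀ σ v → ¬ T (heavy v σ) → h * deg G (classOf σ i) v ≤ ∣ adj G v ∣ + h * L
  light⇒bounded σ v light = begin
    h * deg G (classOf σ i) v      ≤⟨ *-monoʳ-≤ h (s≤s⁻¹ (≰⇒> (light ∘ ≤⇒≤ᵇ))) ⟩
    h * (∣ adj G v ∣ / h + L)      ≡⟨ *-distribˡ-+ h (∣ adj G v ∣ / h) L ⟩
    h * (∣ adj G v ∣ / h) + h * L  ≤⟨ +-monoˡ-≤ (h * L) (n*[m/n]≤m ∣ adj G v ∣ h) ⟩
    ∣ adj G v ∣ + h * L            ∎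
  cover : ∀ σ → T (B <ᵇ edgesWithin G (classOf σ i)) → ∃[ v ] T (heavy v σ)
  cover σ bad with any? (λ v → T? (heavy v σ))
  ... | yes found = found
  ... | no  none  = contradiction (≤-trans sparse n[9+2L]≤B) (<⇒≱ (<ᵇ⇒< B _ bad))
    where
    sparse : edgesWithin G (classOf σ i) ≤ n * (9 + 2 * L)
    sparse = edgesWithin≤n*[9+2L] G (classOf σ i) N h L N≤3h 2m≤N²n (λ v → light⇒bounded σ v (none ∘ (v ,_)))

badCount*n^c≤N^n : ∀ c n .{{_ : NonZero n}} (G : Graph n) N (i : Fin N) L B →
                   n ^ suc c ≤ 2 ^ L → n * (9 + 2 * L) ≤ B → 2 * numEdges G ≤ N * N * n →
                   badCount G N i B * n ^ c ≤ N ^ n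
badCount*n^c≤N^n c n G N@(suc _) i L B n^[1+c]≤2^L n[9+2L]≤B 2m≤N²n with balancedScale N
... | h , N≤3h , [1+N]^h≤2N^h = *-cancelˡ-≤ n (begin
  n * (badCount G N i B * n ^ c)  ≡⟨ x∙yz≈y∙xz n (badCount G N i B) (n ^ c) ⟩
  badCount G N i B * n ^ suc c    ≤⟨ *-monoʳ-≤ (badCount G N i B) n^[1+c]≤2^L ⟩
  badCount G N i B * 2 ^ L        ≤⟨ badCount*2^L≤n*N^n G N i (suc h) L B [1+N]^h≤2N^h N≤3h 2m≤N²n n[9+2L]≤B ⟩
  n * N ^ n                       ∎)

lemma3p28 : (c : ℕ) → Σ ℕ λ C → Σ ℕ λ k → Σ ℕ λ n₀ →
    ∀ (n : ℕ) → n₀ ≤ n → (G : Graph n) → LogHyp n (numEdges G) →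
    ∀ (N : ℕ) → IsCeilSqrtAvgDeg n (numEdges G) N → (i : Fin N) →
    badCount G N i (C * n * ⌈log₂ n ⌉ ^ k) * n ^ c ≤ N ^ n
lemma3p28 c = 9 + 2 * suc c , 1 , 2 , bound
  where
  bound : ∀ n → 2 ≤ n → (G : Graph n) → LogHyp n (numEdges G) →
          ∀ N → IsCeilSqrtAvgDeg n (numEdges G) N → (i : Fin N) →
          badCount G N i ((9 + 2 * suc c) * n * ⌈log₂ n ⌉ ^ 1) * n ^ c ≤ N ^ n
  bound n@(suc (suc _)) (s≤s (s≤s _)) G _ N (2m≤N²n , _) i =
    badCount*n^c≤N^n c n G N i L _ n^[1+c]≤2^L n[9+2L]≤B 2m≤N²n
    where
    L : ℕ
    L = ⌈log₂ n ⌉ * suc c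
    n^[1+c]≤2^L : n ^ suc c ≤ 2 ^ L
    n^[1+c]≤2^L = ≤-trans (^-monoˡ-≤ (suc c) (n≤2^⌈log₂n⌉ n)) (≤-reflexive (^-*-assoc 2 ⌈log₂ n ⌉ (suc c)))
    -- ⌈log₂ n ⌉ reduces to a successor for n ≥ 2, which supplies NonZero ⌈log₂ n ⌉.
    n[9+2L]≤B : n * (9 + 2 * L) ≤ (9 + 2 * suc c) * n * ⌈log₂ n ⌉ ^ 1
    n[9+2L]≤B = n*[9+2ℓk]≤[9+2k]*n*ℓ n ⌈log₂ n ⌉ (suc c)
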